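{- Let $D$ be an extended semicomplete digraph and let $C_1^g$ and $C_2^g$ be vertex-disjoint G-cycles of $D$ such that $D$ contains an arc from $V(C_1^g)$ to $V(C_2^g)$ and an arc from $V(C_2^g)$ to $V(C_1^g)$. Then $D$ has a G-cycle $C^g$ with $V(C^g)=V(C_1^g)\cup V(C_2^g)$ and $\ell(C^g)\ge\ell(C_1^g)+\ell(C_2^g)$.
   Context: All digraphs are finite, without loops or parallel arcs (2-cycles allowed). A semicomplete digraph has at least one arc between every two distinct vertices. $D$ is an extended semicomplete digraph if there are a semicomplete digraph $S$ on $\{1,\ldots,s\}$ and integers $n_1,\ldots,n_s\ge1$ such that $D$ is obtained by replacing each vertex $i$ of $S$ by an independent set $I_i$ of $n_i$ vertices and, for every arc $ij$ of $S$, adding all arcs from $I_i$ to $I_j$; the $I_i$ are the partite sets of $D$. A G-cycle of $D$ is either a directed cycle of $D$, or a sequence of $r\ge1$ pairwise vertex-disjoint directed paths $P_1,\ldots,P_r$ of $D$ (a path may be a single vertex), $P_i$ from $u_i$ to $v_i$, such that $v_i$ and $u_{i+1}$ lie in the same partite set for every $i\in[r]$, where $u_{r+1}=u_1$. Its length $\ell$ is the number of arcs of $D$ it uses. -}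

module Defs where

open import Data.Nat using (ℕ; _+_; _∸_; _≥_)
open import Data.Fin using (Fin)
open import Data.List using (List; []; _∷_; _∷ʳ_; length; map; concat)
open import Data.Nat.ListAction using (sum)
open import Data.Empty using (⊥)
open import Data.List.Relation.Unary.All using (All)
open import Data.List.NonEmpty as L⁺ using (List⁺; _∷_)
open import Data.List.Relation.Unary.Linked using (Linked)
open import Data.List.Relation.Unary.Unique.Propositional using (Unique)
open import Data.List.Membership.Propositional using (_∈_)
open import Data.Product using (Σ; ∃; _×_)
open import Data.Sum using (_⊎_)
open import Relation.Binary.PropositionalEquality using (_≡_; _≢_)
open import Relation.Nullary using (¬_)

-- An extended semicomplete digraph D, given by a semicomplete digraph S on
-- Fin s (arc relation A, loopless, at least one arc between distinct vertices;
-- 2-cycles allowed) and a vertex set Fin N of D together with the map 'part'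
-- sending each vertex of D to the vertex i of S whose independent set I_i
-- contains it.  Surjectivity of 'part' encodes n_i ≥ 1.
-- Arcs of D: u → v iff A (part u) (part v).
record ESD : Set₁ where
  field
    s     : ℕ
    A     : Fin s → Fin s → Set
    A-irrefl      : ∀ i → ¬ A i i
    semicomplete  : ∀ i j → i ≢ j → A i j ⊎ A j i
    N     : ℕ
    part  : Fin N → Fin s
    part-surj : ∀ i → ∃ λ v → part v ≡ i

  Vertex : Set
  Vertex = Fin N

  Arc : Vertex → Vertex → Set
  Arc u v = A (part u) (part v)

  -- Raw data of a G-cycle: a directed cycle (list of its vertices in order)
  -- or a list of nonempty directed paths (each given by its vertex list).
  data GCyc : Set where
    cycleG : List Vertex → GCyc
    pathsG : List (List⁺ Vertex) → GCyc

  EndLink : List⁺ Vertex → List⁺ Vertex → Set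
  EndLink P Q = part (L⁺.last P) ≡ part (L⁺.head Q)

  IsGCycle : GCyc → Set
  -- directed cycle x₁ … x_k (k ≥ 2 since there are no loops), arcs x_i x_{i+1}
  -- and x_k x₁, vertices distinct
  IsGCycle (cycleG []) = ⊥
  IsGCycle (cycleG (x ∷ xs)) =
    length xs ≥ 1 × Unique (x ∷ xs) × Linked Arc ((x ∷ xs) ∷ʳ x)
  IsGCycle (pathsG []) = ⊥
  IsGCycle (pathsG (P ∷ Ps)) =
    Unique (concat (map L⁺.toList (P ∷ Ps)))
    × All (λ Q → Linked Arc (L⁺.toList Q)) (P ∷ Ps)
    × Linked EndLink ((P ∷ Ps) ∷ʳ P)

  verts : GCyc → List Vertex
  verts (cycleG xs) = xs
  verts (pathsG Ps) = concat (map L⁺.toList Ps)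

  len : GCyc → ℕ
  len (cycleG xs) = length xs
  len (pathsG Ps) = sum (map (λ P → L⁺.length P ∸ 1) Ps)

{-# OPTIONS --safe #-}

-- A G-cycle is a closed walk without repeated vertices whose steps are arcs or
-- jumps inside a partite set; its length counts the arcs.  If a vertex x of C₁
-- and a vertex y of C₂ lie in one partite set, redirecting the step into x and
-- the step into y to each other splices C₁ and C₂ without losing an arc.
-- Otherwise, if C₂ meets some partite set twice, at x and y, the same exchange
-- cuts C₂ into two shorter closed walks; x and y have the same arcs to and from
-- C₁, so one piece still has arcs in both directions with C₁ and is merged with
-- it by induction, and the other is spliced back in at the twins.  Finally, if
-- C₂ meets every partite set at most once, open it at a step from a vertex with
-- an arc into C₁ to a vertex with an arc from C₁, and insert the resulting path
-- into C₁ as in path insertion for semicomplete digraphs: vertex by vertex while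
-- its first vertex has arcs both ways with the current closed walk, all at once
-- when that vertex is dominated by it.  This gains an arc, paying for the step
-- dropped when C₂ was opened.
module Submission where

open import Defs
open import Data.Empty using (⊥; ⊥-elim)
open import Data.Fin using (_≟_)
open import Data.List as List using (List; []; _∷_; _++_; _∷ʳ_; length)
import Data.List.Properties as Listₚ
open import Data.List.Membership.Propositional using (_∈_; find; lose)
open import Data.List.Membership.Propositional.Properties using (∈-++⁺ˡ; ∈-++⁺ʳ; ∈-++⁻)
open import Data.List.NonEmpty as L⁺ using (List⁺) renaming (_∷_ to _∷⁺_)
open import Data.List.Relation.Unary.All as All using (All; []; _∷_)
import Data.List.Relation.Unary.All.Properties as Allₚ
open import Data.List.Relation.Unary.AllPairs using (AllPairs; []; _∷_)
open import Data.List.Relation.Unary.Any using (here; there; any?)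
open import Data.List.Relation.Unary.Linked using (Linked; [-]) renaming (_∷_ to _∷ₗ_)
open import Data.List.Relation.Unary.Unique.Propositional using (Unique)
import Data.List.Relation.Unary.Unique.Propositional.Properties as Uniqueₚ
open import Data.List.Relation.Binary.Permutation.Propositional
  using (_↭_; ↭-refl; ↭-sym; ↭-trans; ↭-reflexive; ↭⇒↭ₛ)
open import Data.List.Relation.Binary.Permutation.Propositional.Properties
  using (∈-resp-↭; ++-comm; ++⁺ˡ; ++⁺ʳ; ++⁺; ↭-length)
import Data.List.Relation.Binary.Permutation.Setoid.Properties as Permutationₚ
open import Data.Nat using (ℕ; zero; suc; _+_; _≤_; _<_; _≥_; z≤n; s≤s; z<s)
open import Data.Nat.Properties
  using (≤-refl; ≤-reflexive; ≤-trans; <-≤-trans; ≤-pred; n≮0; m<m+n;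
         +-comm; +-assoc; +-identityʳ; +-monoˡ-≤; +-monoʳ-≤; module ≤-Reasoning)
open import Data.Nat.Tactic.RingSolver using (solve-∀)
open import Data.Product using (Σ; ∃; _×_; _,_)
open import Data.Sum as Sum using (_⊎_; inj₁; inj₂)
open import Data.Unit using (⊤; tt)
open import Relation.Binary.Construct.Closure.ReflexiveTransitive using (Star; ε; _◅_; _◅◅_)
open import Relation.Binary.PropositionalEquality
  using (_≡_; _≢_; refl; sym; trans; cong; cong₂; subst; subst₂; setoid; resp₂; module ≡-Reasoning)
open import Relation.Nullary using (yes; no)

Unique-resp-↭ : {X : Set} {xs ys : List X} → xs ↭ ys → Unique xs → Unique ys
Unique-resp-↭ xs↭ys = Permutationₚ.Unique-resp-↭ (setoid _) (↭⇒↭ₛ xs↭ys)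

Unique-++⁻ˡ : {X : Set} (xs : List X) {ys : List X} → Unique (xs ++ ys) → Unique xs
Unique-++⁻ˡ []       _            = []
Unique-++⁻ˡ (x ∷ xs) (x∉ ∷ uniq) = Allₚ.++⁻ˡ xs x∉ ∷ Unique-++⁻ˡ xs uniq

∈-↭-++ : {X : Set} {xs ys zs : List X} → xs ↭ ys ++ zs →
         ∀ x → (x ∈ xs → x ∈ ys ⊎ x ∈ zs) × (x ∈ ys ⊎ x ∈ zs → x ∈ xs)
∈-↭-++ {ys = ys} xs↭ x =
  (λ x∈ → ∈-++⁻ ys (∈-resp-↭ xs↭ x∈)) ,
  Sum.[ (λ x∈ → ∈-resp-↭ (↭-sym xs↭) (∈-++⁺ˡ x∈)) , (λ x∈ → ∈-resp-↭ (↭-sym xs↭) (∈-++⁺ʳ ys x∈)) ]′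

last-∷ : {X : Set} (x y : X) (ys : List X) → L⁺.last (x ∷⁺ y ∷ ys) ≡ L⁺.last (y ∷⁺ ys)
last-∷ x y ys with List.initLast ys
... | List.[]        = refl
... | _ List.∷ʳ′ _ = refl

module _ (D : ESD) where
  open ESD D

  private
    variable
      u v w x y z : Vertex
      K L M : List Vertex
      m n : ℕ

  Step : Vertex → Vertex → Set
  Step x y = Arc x y ⊎ part x ≡ part y

  ℓˢ : Step x y → ℕ
  ℓˢ (inj₁ _) = 1
  ℓˢ (inj₂ _) = 0

  ℓˢ≤1 : (st : Step x y) → ℓˢ st ≤ 1
  ℓˢ≤1 (inj₁ _) = ≤-refl
  ℓˢ≤1 (inj₂ _) = z≤n

  Arc-respʳ : part y ≡ part z → Arc x y → Arc x z
  Arc-respʳ = subst (A _)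

  Arc-respˡ : part x ≡ part y → Arc x z → Arc y z
  Arc-respˡ {z = z} = subst (λ i → A i (part z))

  retarget : part y ≡ part z → Step x y → Step x z
  retarget y~z (inj₁ xy)  = inj₁ (Arc-respʳ y~z xy)
  retarget y~z (inj₂ x~y) = inj₂ (trans x~y y~z)

  ℓˢ-retarget : (y~z : part y ≡ part z) (st : Step x y) → ℓˢ (retarget y~z st) ≡ ℓˢ st
  ℓˢ-retarget _ (inj₁ _) = refl
  ℓˢ-retarget _ (inj₂ _) = refl

  Walk : Vertex → Vertex → Set
  Walk = Star Step

  -- Split off so that vertices p is a cons for every p.
  tail-vertices : Walk u v → List Vertex
  tail-vertices ε                 = []
  tail-vertices (_◅_ {j = w} _ p) = w ∷ tail-vertices p

  vertices : Walk u v → List Vertex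
  vertices {u} p = u ∷ tail-vertices p

  ℓʷ : Walk u v → ℕ
  ℓʷ ε        = 0
  ℓʷ (st ◅ p) = ℓˢ st + ℓʷ p

  last∈vertices : (p : Walk u v) → v ∈ vertices p
  last∈vertices ε       = here refl
  last∈vertices (_ ◅ p) = there (last∈vertices p)

  vertices-◅◅ : (p : Walk u v) (st : Step v w) (q : Walk w x) →
                vertices (p ◅◅ st ◅ q) ≡ vertices p ++ vertices q
  vertices-◅◅ ε       _  _ = refl
  vertices-◅◅ {u = u} (_ ◅ p) st q = cong (u ∷_) (vertices-◅◅ p st q)

  ℓʷ-◅◅ : (p : Walk u v) (st : Step v w) (q : Walk w x) →
          ℓʷ (p ◅◅ st ◅ q) ≡ ℓʷ p + (ℓˢ st + ℓʷ q)
  ℓʷ-◅◅ ε         _  _ = refl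
  ℓʷ-◅◅ (st′ ◅ p) st q = trans (cong (ℓˢ st′ +_) (ℓʷ-◅◅ p st q)) (sym (+-assoc (ℓˢ st′) _ _))

  data Cut {u v : Vertex} : Walk u v → Step x y → Set where
    cut : (p : Walk u x) (st : Step x y) (q : Walk y v) → Cut (p ◅◅ st ◅ q) st

  cut-∷ : (st : Step u w) {p : Walk w v} {st′ : Step x y} → Cut p st′ → Cut (st ◅ p) st′
  cut-∷ st (cut p st′ q) = cut (st ◅ p) st′ q

  cut-at : (p : Walk u v) → x ∈ vertices p → x ≡ u ⊎ Σ Vertex λ w → Σ (Step w x) (Cut p)
  cut-at p        (here x≡u)  = inj₁ x≡u
  cut-at ε        (there ())
  cut-at (st ◅ p) (there x∈) with cut-at p x∈
  ... | inj₁ refl            = inj₂ (_ , st , cut ε st p)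
  ... | inj₂ (_ , st′ , c)   = inj₂ (_ , st′ , cut-∷ st c)

  infix 4.5 _↺_
  record ClosedWalk : Set where
    constructor _↺_
    field
      {first last} : Vertex
      path         : Walk first last
      back         : Step last first

  private
    variable
      a b c d : ClosedWalk

  verticesᶜ : ClosedWalk → List Vertex
  verticesᶜ (p ↺ _) = vertices p

  ℓᶜ : ClosedWalk → ℕ
  ℓᶜ (p ↺ k) = ℓʷ p + ℓˢ k

  infix 3 _≈_
  _≈_ : ClosedWalk → ClosedWalk → Set
  c ≈ d = verticesᶜ c ↭ verticesᶜ d × ℓᶜ c ≡ ℓᶜ d

  ≈-trans : a ≈ b → b ≈ c → a ≈ c
  ≈-trans (a↭b , ℓab) (b↭c , ℓbc) = ↭-trans a↭b b↭c , trans ℓab ℓbc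

  rotate-cut : (p : Walk u x) (st : Step x y) (q : Walk y v) (k : Step v u) →
               q ◅◅ k ◅ p ↺ st ≈ p ◅◅ st ◅ q ↺ k
  rotate-cut p st q k =
    ↭-trans (↭-reflexive (vertices-◅◅ q k p))
      (↭-trans (++-comm (vertices q) (vertices p)) (↭-reflexive (sym (vertices-◅◅ p st q)))) ,
    (begin
      ℓʷ (q ◅◅ k ◅ p) + ℓˢ st         ≡⟨ cong (_+ ℓˢ st) (ℓʷ-◅◅ q k p) ⟩
      ℓʷ q + (ℓˢ k + ℓʷ p) + ℓˢ st    ≡⟨ rearrange (ℓʷ q) (ℓˢ k) (ℓʷ p) (ℓˢ st) ⟩
      ℓʷ p + (ℓˢ st + ℓʷ q) + ℓˢ k    ≡⟨ cong (_+ ℓˢ k) (ℓʷ-◅◅ p st q) ⟨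
      ℓʷ (p ◅◅ st ◅ q) + ℓˢ k         ∎)
    where
    open ≡-Reasoning
    rearrange : ∀ i j k l → i + (j + k) + l ≡ k + (l + i) + j
    rearrange = solve-∀

  Rotation : Vertex → ClosedWalk → Set
  Rotation x c = Σ Vertex λ y → Σ (Walk x y) λ p → Σ (Step y x) λ k → p ↺ k ≈ c

  rotate : (c : ClosedWalk) → x ∈ verticesᶜ c → Rotation x c
  rotate (p ↺ k) x∈ with cut-at p x∈
  ... | inj₁ refl                    = _ , p , k , ↭-refl , refl
  ... | inj₂ (_ , _ , cut p₁ st p₂)  = _ , p₂ ◅◅ k ◅ p₁ , st , rotate-cut p₁ st p₂ k

  Tour : List Vertex → ℕ → Set
  Tour L n = Σ ClosedWalk λ c → verticesᶜ c ↭ L × n ≤ ℓᶜ c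

  tour-resp : L ↭ M → m ≤ n → Tour L n → Tour M m
  tour-resp L↭M m≤n (c , c↭L , n≤c) = c , ↭-trans c↭L L↭M , ≤-trans m≤n n≤c

  -- Splitting and splicing at twins

  infix 3 _≋_⊕_
  _≋_⊕_ : ClosedWalk → ClosedWalk → ClosedWalk → Set
  c ≋ a ⊕ b = verticesᶜ a ++ verticesᶜ b ↭ verticesᶜ c × ℓᶜ a + ℓᶜ b ≡ ℓᶜ c

  ⊕-comm : c ≋ a ⊕ b → c ≋ b ⊕ a
  ⊕-comm {a = a} {b = b} (ab↭c , ℓab) =
    ↭-trans (++-comm (verticesᶜ b) (verticesᶜ a)) ab↭c , trans (+-comm (ℓᶜ b) (ℓᶜ a)) ℓab

  -- Exchanging the targets of st and k cuts one closed walk into two or, read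
  -- backwards, joins two into one.
  cross : (p : Walk x u) (st : Step u y) (q : Walk y v) (k : Step v x)
          (st′ : Step u x) (k′ : Step v y) → ℓˢ st′ ≡ ℓˢ st → ℓˢ k′ ≡ ℓˢ k →
          p ◅◅ st ◅ q ↺ k ≋ (p ↺ st′) ⊕ (q ↺ k′)
  cross p st q k st′ k′ ℓst′ ℓk′ =
    ↭-reflexive (sym (vertices-◅◅ p st q)) ,
    (begin
      ℓʷ p + ℓˢ st′ + (ℓʷ q + ℓˢ k′)  ≡⟨ cong₂ (λ i j → ℓʷ p + i + (ℓʷ q + j)) ℓst′ ℓk′ ⟩
      ℓʷ p + ℓˢ st + (ℓʷ q + ℓˢ k)    ≡⟨ rearrange (ℓʷ p) (ℓˢ st) (ℓʷ q) (ℓˢ k) ⟩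
      ℓʷ p + (ℓˢ st + ℓʷ q) + ℓˢ k    ≡⟨ cong (_+ ℓˢ k) (ℓʷ-◅◅ p st q) ⟨
      ℓʷ (p ◅◅ st ◅ q) + ℓˢ k         ∎)
    where
    open ≡-Reasoning
    rearrange : ∀ i j k l → i + j + (k + l) ≡ i + (j + k) + l
    rearrange = solve-∀

  splice : (a b : ClosedWalk) → x ∈ verticesᶜ a → y ∈ verticesᶜ b → part x ≡ part y →
           Tour (verticesᶜ a ++ verticesᶜ b) (ℓᶜ a + ℓᶜ b)
  splice a b x∈ y∈ x~y with rotate a x∈ | rotate b y∈
  ... | _ , p , k , p↭ , ℓp | _ , q , m , q↭ , ℓq =
    let pq↭ , ℓpq = cross p (retarget x~y k) q (retarget (sym x~y) m) k m
                      (sym (ℓˢ-retarget x~y k)) (sym (ℓˢ-retarget (sym x~y) m))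
    in _ , ↭-trans (↭-sym pq↭) (++⁺ p↭ q↭) , ≤-reflexive (trans (cong₂ _+_ (sym ℓp) (sym ℓq)) ℓpq)

  split : (c : ClosedWalk) → x ∈ verticesᶜ c → y ∈ verticesᶜ c → x ≢ y → part x ≡ part y →
          Σ ClosedWalk λ a → Σ ClosedWalk λ b → x ∈ verticesᶜ a × y ∈ verticesᶜ b × c ≋ a ⊕ b
  split c x∈ y∈ x≢y x~y with rotate c x∈
  ... | _ , q , k , q↭ , ℓq with cut-at q (∈-resp-↭ (↭-sym q↭) y∈)
  ...   | inj₁ y≡x = ⊥-elim (x≢y (sym y≡x))
  ...   | inj₂ (_ , _ , cut q₁ st q₂) =
    let q₁q₂↭ , ℓq₁q₂ = cross q₁ st q₂ k (retarget (sym x~y) st) (retarget x~y k)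
                          (ℓˢ-retarget (sym x~y) st) (ℓˢ-retarget x~y k)
    in _ , _ , here refl , here refl , ↭-trans q₁q₂↭ q↭ , trans ℓq₁q₂ ℓq

  piece-shorter : c ≋ a ⊕ b → length (verticesᶜ a) < length (verticesᶜ c)
  piece-shorter {c = c} {a = a} {b = b} (ab↭c , _) = begin-strict
    length (verticesᶜ a)                          <⟨ m<m+n _ z<s ⟩
    length (verticesᶜ a) + length (verticesᶜ b)   ≡⟨ Listₚ.length-++ (verticesᶜ a) ⟨
    length (verticesᶜ a ++ verticesᶜ b)           ≡⟨ ↭-length ab↭c ⟩
    length (verticesᶜ c)                          ∎
    where open ≤-Reasoning

  piece-unique : c ≋ a ⊕ b → Unique (verticesᶜ c) → Unique (verticesᶜ a)
  piece-unique {a = a} (ab↭c , _) uniq = Unique-++⁻ˡ (verticesᶜ a) (Unique-resp-↭ (↭-sym ab↭c) uniq)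

  absorb-piece : c ≋ a ⊕ b → x ∈ verticesᶜ a → y ∈ verticesᶜ b → part x ≡ part y →
                 Tour (L ++ verticesᶜ a) (n + ℓᶜ a) → Tour (L ++ verticesᶜ c) (n + ℓᶜ c)
  absorb-piece {c = c} {a = a} {b = b} {L = L} {n = n} (ab↭c , ℓab) x∈ y∈ x~y (t , t↭ , n≤t) =
    tour-resp perm arith (splice t b (∈-resp-↭ (↭-sym t↭) (∈-++⁺ʳ L x∈)) y∈ x~y)
    where
    perm : verticesᶜ t ++ verticesᶜ b ↭ L ++ verticesᶜ c
    perm = ↭-trans (++⁺ʳ (verticesᶜ b) t↭)
             (↭-trans (↭-reflexive (Listₚ.++-assoc L (verticesᶜ a) (verticesᶜ b))) (++⁺ˡ L ab↭c))
    arith : n + ℓᶜ c ≤ ℓᶜ t + ℓᶜ b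
    arith = begin
      n + ℓᶜ c            ≡⟨ cong (n +_) ℓab ⟨
      n + (ℓᶜ a + ℓᶜ b)   ≡⟨ +-assoc n (ℓᶜ a) (ℓᶜ b) ⟨
      n + ℓᶜ a + ℓᶜ b     ≤⟨ +-monoˡ-≤ (ℓᶜ b) n≤t ⟩
      ℓᶜ t + ℓᶜ b         ∎
      where open ≤-Reasoning

  -- Path insertion

  module _ (X Y : Vertex → Set) where

    XYStep : Walk u v → Set
    XYStep p = Σ Vertex λ x → Σ Vertex λ y → Σ (Step x y) (Cut p) × X x × Y y

    XYStep-∷ : (st : Step u w) {p : Walk w v} → XYStep p → XYStep (st ◅ p)
    XYStep-∷ st (_ , _ , (st′ , c) , Xx , Yy) = _ , _ , (st′ , cut-∷ st c) , Xx , Yy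

    first-XY-step : (p : Walk u v) → (∀ {z} → z ∈ vertices p → X z ⊎ Y z) →
                    x ∈ vertices p → X x → XYStep p ⊎ X v
    first-XY-step ε        _  (here refl) Xx = inj₂ Xx
    first-XY-step ε        _  (there ())  _
    first-XY-step (st ◅ p) XY (here refl) Xx with XY (there (here refl))
    ... | inj₂ Yw = inj₁ (_ , _ , (st , cut ε st p) , Xx , Yw)
    ... | inj₁ Xw = Sum.map₁ (XYStep-∷ st) (first-XY-step p (λ z∈ → XY (there z∈)) (here refl) Xw)
    first-XY-step (st ◅ p) XY (there x∈) Xx =
      Sum.map₁ (XYStep-∷ st) (first-XY-step p (λ z∈ → XY (there z∈)) x∈ Xx)

    XYRotation : ClosedWalk → Set
    XYRotation c = Σ Vertex λ y → Σ Vertex λ x → Σ (Walk y x) λ p → Σ (Step x y) λ k →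
                   Y y × X x × p ↺ k ≈ c

    rotate-to-XY : (c : ClosedWalk) → (∀ {z} → z ∈ verticesᶜ c → X z ⊎ Y z) →
                   x ∈ verticesᶜ c → X x → y ∈ verticesᶜ c → Y y → XYRotation c
    rotate-to-XY c XY x∈ Xx y∈ Yy with rotate c y∈
    ... | _ , p , k , p≈c@(p↭ , _)
      with first-XY-step p (λ z∈ → XY (∈-resp-↭ p↭ z∈)) (∈-resp-↭ (↭-sym p↭) x∈) Xx
    ...   | inj₂ Xl = _ , _ , p , k , Yy , Xl , p≈c
    ...   | inj₁ (_ , _ , (_ , cut p₁ st p₂) , Xs , Yt) =
      _ , _ , p₂ ◅◅ k ◅ p₁ , st , Yt , Xs , ≈-trans (rotate-cut p₁ st p₂ k) p≈c

  SendsInto ReceivesFrom : List Vertex → Vertex → Set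
  SendsInto    L y = Σ Vertex λ a → a ∈ L × Arc y a
  ReceivesFrom L y = Σ Vertex λ a → a ∈ L × Arc a y

  sends-or-receives : u ∈ L → part z ≢ part u → SendsInto L z ⊎ ReceivesFrom L z
  sends-or-receives {u = u} u∈ z≁u =
    Sum.map (λ zu → u , u∈ , zu) (λ uz → u , u∈ , uz) (semicomplete _ _ z≁u)

  sends-or-dominated : (L : List Vertex) (y : Vertex) → (∀ {a} → a ∈ L → part a ≢ part y) →
                       SendsInto L y ⊎ (∀ {a} → a ∈ L → Arc a y)
  sends-or-dominated []      y _   = inj₂ λ ()
  sends-or-dominated (a ∷ L) y a≁y with semicomplete (part a) (part y) (a≁y (here refl))
  ... | inj₂ ya = inj₁ (a , here refl , ya)
  ... | inj₁ ay with sends-or-dominated L y (λ b∈ → a≁y (there b∈))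
  ...   | inj₁ (b , b∈ , yb) = inj₁ (b , there b∈ , yb)
  ...   | inj₂ dominated     = inj₂ λ { (here refl) → ay ; (there b∈) → dominated b∈ }

  PartDisjoint : List Vertex → List Vertex → Set
  PartDisjoint L M = ∀ {a b} → a ∈ L → b ∈ M → part a ≢ part b

  PartDistinct : List Vertex → Set
  PartDistinct = AllPairs (λ a b → part a ≢ part b)

  PartDistinct-resp-↭ : L ↭ M → PartDistinct L → PartDistinct M
  PartDistinct-resp-↭ L↭M =
    Permutationₚ.AllPairs-resp-↭ (setoid Vertex) (λ a≁b b~a → a≁b (sym b~a))
      (resp₂ (λ a b → part a ≢ part b)) (↭⇒↭ₛ L↭M)

  twin-across : (L M : List Vertex) →
                (Σ Vertex λ x → Σ Vertex λ y → x ∈ L × y ∈ M × part x ≡ part y) ⊎ PartDisjoint L M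
  twin-across L M with any? (λ x → any? (λ y → part x ≟ part y) M) L
  ... | yes twin = let x , x∈ , twin′ = find twin ; y , y∈ , x~y = find twin′
                   in inj₁ (x , y , x∈ , y∈ , x~y)
  ... | no ¬twin = inj₂ λ x∈ y∈ x~y → ¬twin (lose x∈ (lose y∈ x~y))

  twin-within : (L : List Vertex) → Unique L →
                (Σ Vertex λ x → Σ Vertex λ y → x ∈ L × y ∈ L × x ≢ y × part x ≡ part y)
                ⊎ PartDistinct L
  twin-within []      _           = inj₂ []
  twin-within (x ∷ L) (x∉ ∷ uniq) with any? (λ y → part x ≟ part y) L
  ... | yes twin = let y , y∈ , x~y = find twin
                   in inj₁ (x , y , here refl , there y∈ , All.lookup x∉ y∈ , x~y)
  ... | no ¬twin = Sum.map (λ (x′ , y , x′∈ , y∈ , twins) → x′ , y , there x′∈ , there y∈ , twins)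
                           (All.tabulate (λ y∈ x~y → ¬twin (lose y∈ x~y)) ∷_)
                           (twin-within L uniq)

  detour : (p : Walk u v) (k : Step v u) → p ↺ k ≈ c → Arc v x → (P : Walk x y) → Arc y u →
           Tour (verticesᶜ c ++ vertices P) (ℓᶜ c + suc (ℓʷ P))
  detour {c = c} p k (p↭ , ℓp) vx P yu =
    p ◅◅ inj₁ vx ◅ P ↺ inj₁ yu ,
    ↭-trans (↭-reflexive (vertices-◅◅ p (inj₁ vx) P)) (++⁺ʳ (vertices P) p↭) ,
    arith
    where
    open ≤-Reasoning
    rearrange : ∀ i j → i + 1 + suc j ≡ i + (1 + j) + 1
    rearrange = solve-∀
    arith : ℓᶜ c + suc (ℓʷ P) ≤ ℓʷ (p ◅◅ inj₁ vx ◅ P) + 1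
    arith = begin
      ℓᶜ c + suc (ℓʷ P)              ≡⟨ cong (_+ suc (ℓʷ P)) ℓp ⟨
      ℓʷ p + ℓˢ k + suc (ℓʷ P)       ≤⟨ +-monoˡ-≤ (suc (ℓʷ P)) (+-monoʳ-≤ (ℓʷ p) (ℓˢ≤1 k)) ⟩
      ℓʷ p + 1 + suc (ℓʷ P)          ≡⟨ rearrange (ℓʷ p) (ℓʷ P) ⟩
      ℓʷ p + (1 + ℓʷ P) + 1          ≡⟨ cong (_+ 1) (ℓʷ-◅◅ p (inj₁ vx) P) ⟨
      ℓʷ (p ◅◅ inj₁ vx ◅ P) + 1      ∎

  insert-vertex : (c : ClosedWalk) → (∀ {a} → a ∈ verticesᶜ c → part a ≢ part y) →
                  x ∈ verticesᶜ c → Arc x y → z ∈ verticesᶜ c → Arc y z →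
                  Tour (verticesᶜ c ++ y ∷ []) (ℓᶜ c + 1)
  insert-vertex {y = y} c c≁y x∈ xy z∈ yz
    with rotate-to-XY (λ a → Arc a y) (Arc y) c (λ a∈ → semicomplete _ _ (c≁y a∈)) x∈ xy z∈ yz
  ... | _ , _ , p , k , yh , ly , p≈c = detour p k p≈c ly ε yh

  insert-dominated-path : (c : ClosedWalk) (P : Walk x y) → (∀ {a} → a ∈ verticesᶜ c → Arc a x) →
                          z ∈ verticesᶜ c → Arc y z →
                          Tour (verticesᶜ c ++ vertices P) (ℓᶜ c + suc (ℓʷ P))
  insert-dominated-path c P dominated z∈ yz with rotate c z∈
  ... | _ , p , k , p≈c@(p↭ , _) = detour p k p≈c (dominated (∈-resp-↭ p↭ (last∈vertices p))) P yz

  insert-path : (c : ClosedWalk) (P : Walk x y) → PartDisjoint (verticesᶜ c) (vertices P) →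
                PartDistinct (vertices P) → u ∈ verticesᶜ c → Arc u x → v ∈ verticesᶜ c → Arc y v →
                Tour (verticesᶜ c ++ vertices P) (ℓᶜ c + suc (ℓʷ P))
  insert-path c ε disjoint _ u∈ ux v∈ xv =
    insert-vertex c (λ a∈ → disjoint a∈ (here refl)) u∈ ux v∈ xv
  insert-path c (inj₂ x~w ◅ P) _ ((x≁w ∷ _) ∷ _) _ _ _ _ = ⊥-elim (x≁w x~w)
  insert-path {x = x} c (inj₁ xw ◅ P) disjoint (x≁P ∷ distinct) u∈ ux v∈ yv
    with sends-or-dominated (verticesᶜ c) x (λ a∈ → disjoint a∈ (here refl))
  ... | inj₂ dominated = insert-dominated-path c (inj₁ xw ◅ P) dominated v∈ yv
  ... | inj₁ (_ , z∈ , xz) with insert-vertex c (λ a∈ → disjoint a∈ (here refl)) u∈ ux z∈ xz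
  ...   | c′ , c′↭ , ℓc′ =
    tour-resp perm arith
      (insert-path c′ P disjoint′ distinct
                   (∈-resp-↭ (↭-sym c′↭) (∈-++⁺ʳ (verticesᶜ c) (here refl))) xw
                   (∈-resp-↭ (↭-sym c′↭) (∈-++⁺ˡ v∈)) yv)
    where
    disjoint′ : PartDisjoint (verticesᶜ c′) (vertices P)
    disjoint′ a∈ b∈ with ∈-++⁻ (verticesᶜ c) (∈-resp-↭ c′↭ a∈)
    ... | inj₁ a∈c        = disjoint a∈c (there b∈)
    ... | inj₂ (here refl) = All.lookup x≁P b∈
    perm : verticesᶜ c′ ++ vertices P ↭ verticesᶜ c ++ x ∷ vertices P
    perm = ↭-trans (++⁺ʳ (vertices P) c′↭)
             (↭-reflexive (Listₚ.++-assoc (verticesᶜ c) (x ∷ []) (vertices P)))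
    arith : ℓᶜ c + suc (suc (ℓʷ P)) ≤ ℓᶜ c′ + suc (ℓʷ P)
    arith = ≤-trans (≤-reflexive (sym (+-assoc (ℓᶜ c) 1 _))) (+-monoˡ-≤ _ ℓc′)

  -- Merging closed walks

  ArcFrom : List Vertex → List Vertex → Set
  ArcFrom L M = Σ Vertex λ a → Σ Vertex λ b → a ∈ L × b ∈ M × Arc a b

  infix 4 _⇄_
  _⇄_ : List Vertex → List Vertex → Set
  L ⇄ M = ArcFrom L M × ArcFrom M L

  ⇄-respʳ-↭ : M ↭ K → L ⇄ M → L ⇄ K
  ⇄-respʳ-↭ M↭K ((a , b , a∈ , b∈ , ab) , (b′ , a′ , b′∈ , a′∈ , b′a′)) =
    (a , b , a∈ , ∈-resp-↭ M↭K b∈ , ab) , (b′ , a′ , ∈-resp-↭ M↭K b′∈ , a′∈ , b′a′)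

  -- x and y have the same arcs to and from L; either both send an arc into L
  -- or L dominates both.
  ⇄-++ : x ∈ M → y ∈ K → part x ≡ part y → (∀ {a} → a ∈ L → part a ≢ part x) →
         L ⇄ M ++ K → L ⇄ M ⊎ L ⇄ K
  ⇄-++ {x = x} {M = M} {y = y} {L = L} x∈ y∈ x~y L≁x
       ((a , b , a∈ , b∈ , ab) , (b′ , a′ , b′∈ , a′∈ , b′a′))
    with sends-or-dominated L x L≁x | ∈-++⁻ M b∈ | ∈-++⁻ M b′∈
  ... | inj₁ (a″ , a″∈ , xa″) | inj₁ b∈M | _ =
    inj₁ ((a , b , a∈ , b∈M , ab) , (x , a″ , x∈ , a″∈ , xa″))
  ... | inj₁ (a″ , a″∈ , xa″) | inj₂ b∈K | _ =
    inj₂ ((a , b , a∈ , b∈K , ab) , (y , a″ , y∈ , a″∈ , Arc-respˡ x~y xa″))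
  ... | inj₂ dominated | _ | inj₁ b′∈M =
    inj₁ ((a , x , a∈ , x∈ , dominated a∈) , (b′ , a′ , b′∈M , a′∈ , b′a′))
  ... | inj₂ dominated | _ | inj₂ b′∈K =
    inj₂ ((a , y , a∈ , y∈ , Arc-respʳ x~y (dominated a∈)) , (b′ , a′ , b′∈K , a′∈ , b′a′))

  Mergeable : ClosedWalk → ClosedWalk → Set
  Mergeable a b = Unique (verticesᶜ b) → verticesᶜ a ⇄ verticesᶜ b →
                  Tour (verticesᶜ a ++ verticesᶜ b) (ℓᶜ a + ℓᶜ b)

  absorb-part-distinct : (a b : ClosedWalk) → PartDisjoint (verticesᶜ a) (verticesᶜ b) →
                         PartDistinct (verticesᶜ b) → verticesᶜ a ⇄ verticesᶜ b →
                         Tour (verticesᶜ a ++ verticesᶜ b) (ℓᶜ a + ℓᶜ b)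
  absorb-part-distinct a b disjoint distinct ((u , v , u∈ , v∈ , uv) , (v′ , u′ , v′∈ , u′∈ , v′u′))
    with rotate-to-XY (SendsInto (verticesᶜ a)) (ReceivesFrom (verticesᶜ a)) b
           (λ z∈ → sends-or-receives u∈ (λ z~u → disjoint u∈ z∈ (sym z~u)))
           v′∈ (u′ , u′∈ , v′u′) v∈ (u , u∈ , uv)
  ... | _ , _ , p , k , (_ , u₁∈ , u₁h) , (_ , u₂∈ , lu₂) , p↭ , ℓp =
    tour-resp (++⁺ˡ (verticesᶜ a) p↭) arith
      (insert-path a p (λ a∈ b∈ → disjoint a∈ (∈-resp-↭ p↭ b∈))
                   (PartDistinct-resp-↭ (↭-sym p↭) distinct) u₁∈ u₁h u₂∈ lu₂)
    where
    open ≤-Reasoning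
    arith : ℓᶜ a + ℓᶜ b ≤ ℓᶜ a + suc (ℓʷ p)
    arith = +-monoʳ-≤ (ℓᶜ a) (begin
      ℓᶜ b           ≡⟨ ℓp ⟨
      ℓʷ p + ℓˢ k    ≤⟨ +-monoʳ-≤ (ℓʷ p) (ℓˢ≤1 k) ⟩
      ℓʷ p + 1       ≡⟨ +-comm (ℓʷ p) 1 ⟩
      suc (ℓʷ p)     ∎)

  merge-step : (a b : ClosedWalk) →
               (∀ c → length (verticesᶜ c) < length (verticesᶜ b) → Mergeable a c) → Mergeable a b
  merge-step a b IH unique-b a⇄b with twin-across (verticesᶜ a) (verticesᶜ b)
  ... | inj₁ (_ , _ , x∈ , y∈ , x~y) = splice a b x∈ y∈ x~y
  ... | inj₂ disjoint with twin-within (verticesᶜ b) unique-b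
  ...   | inj₂ distinct = absorb-part-distinct a b disjoint distinct a⇄b
  ...   | inj₁ (_ , _ , x∈ , y∈ , x≢y , x~y) with split b x∈ y∈ x≢y x~y
  ...     | c , d , x∈c , y∈d , b≋c⊕d@(cd↭b , _)
    with ⇄-++ x∈c y∈d x~y (λ u∈ → disjoint u∈ x∈) (⇄-respʳ-↭ (↭-sym cd↭b) a⇄b)
  ... | inj₁ a⇄c = absorb-piece {L = verticesᶜ a} {n = ℓᶜ a} b≋c⊕d x∈c y∈d x~y
                     (IH c (piece-shorter b≋c⊕d) (piece-unique b≋c⊕d unique-b) a⇄c)
  ... | inj₂ a⇄d = absorb-piece {L = verticesᶜ a} {n = ℓᶜ a} b≋d⊕c y∈d x∈c (sym x~y)
                     (IH d (piece-shorter b≋d⊕c) (piece-unique b≋d⊕c unique-b) a⇄d)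
    where
    b≋d⊕c : b ≋ d ⊕ c
    b≋d⊕c = ⊕-comm b≋c⊕d

  merge : (n : ℕ) (a b : ClosedWalk) → length (verticesᶜ b) ≤ n → Mergeable a b
  merge zero    a b b≤0 = merge-step a b λ _ c<b → ⊥-elim (n≮0 (<-≤-trans c<b b≤0))
  merge (suc n) a b b≤n = merge-step a b λ c c<b → merge n a c (≤-pred (<-≤-trans c<b b≤n))

  -- G-cycles as closed walks

  GCycleOn : List Vertex → ℕ → Set
  GCycleOn L n = Σ GCyc λ C → IsGCycle C × verts C ↭ L × n ≤ len C

  GCycleOn-resp : L ↭ M → m ≤ n → GCycleOn L n → GCycleOn M m
  GCycleOn-resp L↭M m≤n (C , isC , C↭L , n≤C) = C , isC , ↭-trans C↭L L↭M , ≤-trans m≤n n≤C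

  unique : (C : GCyc) → IsGCycle C → Unique (verts C)
  unique (cycleG [])      ()
  unique (cycleG (_ ∷ _)) (_ , uniq , _) = uniq
  unique (pathsG [])      ()
  unique (pathsG (_ ∷ _)) (uniq , _)     = uniq

  arc-cycle-walk : (x : Vertex) (xs : List Vertex) → Linked Arc ((x ∷ xs) ∷ʳ z) →
                   Σ Vertex λ y → Σ (Walk x y) λ p →
                     Arc y z × vertices p ≡ x ∷ xs × ℓʷ p ≡ length xs
  arc-cycle-walk x []       (xz ∷ₗ [-])     = x , ε , xz , refl , refl
  arc-cycle-walk x (y ∷ ys) (xy ∷ₗ linked) with arc-cycle-walk y ys linked
  ... | _ , p , r , vp , ℓp = _ , inj₁ xy ◅ p , r , cong (x ∷_) vp , cong suc ℓp

  arc-path-walk : (x : Vertex) (xs : List Vertex) → Linked Arc (x ∷ xs) →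
                  Σ Vertex λ y → Σ (Walk x y) λ p →
                    y ≡ L⁺.last (x ∷⁺ xs) × vertices p ≡ x ∷ xs × ℓʷ p ≡ length xs
  arc-path-walk x []       [-]             = x , ε , refl , refl , refl
  arc-path-walk x (y ∷ ys) (xy ∷ₗ linked) with arc-path-walk y ys linked
  ... | _ , p , e , vp , ℓp =
    _ , inj₁ xy ◅ p , trans e (sym (last-∷ x y ys)) , cong (x ∷_) vp , cong suc ℓp

  paths-walk : (P : List⁺ Vertex) (Ps : List (List⁺ Vertex)) (Z : List⁺ Vertex) →
               All (λ Q → Linked Arc (L⁺.toList Q)) (P ∷ Ps) → Linked EndLink ((P ∷ Ps) ∷ʳ Z) →
               Σ Vertex λ y → Σ (Walk (L⁺.head P) y) λ p → part y ≡ part (L⁺.head Z) ×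
                 vertices p ≡ verts (pathsG (P ∷ Ps)) × ℓʷ p ≡ len (pathsG (P ∷ Ps))
  paths-walk (x ∷⁺ xs) [] Z (linked ∷ []) (link ∷ₗ [-]) with arc-path-walk x xs linked
  ... | _ , p , e , vp , ℓp =
    _ , p , trans (cong part e) link ,
    trans vp (sym (Listₚ.++-identityʳ _)) , trans ℓp (sym (+-identityʳ _))
  paths-walk (x ∷⁺ xs) (P ∷ Ps) Z (linked ∷ linkeds) (link ∷ₗ links)
    with arc-path-walk x xs linked | paths-walk P Ps Z linkeds links
  ... | _ , p , e , vp , ℓp | _ , q , e′ , vq , ℓq =
    _ , p ◅◅ inj₂ (trans (cong part e) link) ◅ q , e′ ,
    trans (vertices-◅◅ p _ q) (cong₂ _++_ vp vq) , trans (ℓʷ-◅◅ p _ q) (cong₂ _+_ ℓp ℓq)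

  fromGCycle : (C : GCyc) → IsGCycle C → Σ ClosedWalk λ c → verticesᶜ c ≡ verts C × ℓᶜ c ≡ len C
  fromGCycle (cycleG (x ∷ xs)) (_ , _ , linked) with arc-cycle-walk x xs linked
  ... | _ , p , r , vp , ℓp = p ↺ inj₁ r , vp , trans (cong (_+ 1) ℓp) (+-comm (length xs) 1)
  fromGCycle (pathsG (P ∷ Ps)) (_ , linkeds , links) with paths-walk P Ps P linkeds links
  ... | _ , p , e , vp , ℓp = p ↺ inj₂ e , vp , trans (+-identityʳ _) ℓp

  relinkˡ : {Q Q′ : List⁺ Vertex} (Qs : List (List⁺ Vertex)) →
            part (L⁺.last Q) ≡ part (L⁺.last Q′) →
            Linked EndLink (Q′ ∷ Qs) → Linked EndLink (Q ∷ Qs)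
  relinkˡ []      _ [-]             = [-]
  relinkˡ (_ ∷ _) e (link ∷ₗ links) = trans e link ∷ₗ links

  relinkʳ : {Z Z′ : List⁺ Vertex} (Qs : List (List⁺ Vertex)) →
            part (L⁺.head Z) ≡ part (L⁺.head Z′) →
            Linked EndLink (Qs ∷ʳ Z) → Linked EndLink (Qs ∷ʳ Z′)
  relinkʳ []           _ _                 = [-]
  relinkʳ (_ ∷ [])     e (link ∷ₗ [-])     = trans link e ∷ₗ [-]
  relinkʳ (_ ∷ Q ∷ Qs) e (link ∷ₗ links)   = link ∷ₗ relinkʳ (Q ∷ Qs) e links

  Segments : Walk u v → List⁺ Vertex → Set
  Segments {u} p Z = Σ (List⁺ Vertex) λ Q → Σ (List (List⁺ Vertex)) λ Qs → L⁺.head Q ≡ u ×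
    All (λ Q → Linked Arc (L⁺.toList Q)) (Q ∷ Qs) × Linked EndLink ((Q ∷ Qs) ∷ʳ Z) ×
    verts (pathsG (Q ∷ Qs)) ≡ vertices p × len (pathsG (Q ∷ Qs)) ≡ ℓʷ p

  segments : (p : Walk u v) (Z : List⁺ Vertex) → part v ≡ part (L⁺.head Z) → Segments p Z
  segments {u} ε Z e = u ∷⁺ [] , [] , refl , [-] ∷ [] , e ∷ₗ [-] , refl , refl
  segments {u} (inj₁ uw ◅ p) Z e with segments p Z e
  ... | w ∷⁺ ws , Qs , refl , linked ∷ linkeds , links , vQ , ℓQ =
    u ∷⁺ w ∷ ws , Qs , refl , (uw ∷ₗ linked) ∷ linkeds ,
    relinkˡ (Qs ∷ʳ Z) (cong part (last-∷ u w ws)) links , cong (u ∷_) vQ , cong suc ℓQ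
  segments {u} (inj₂ u~w ◅ p) Z e with segments p Z e
  ... | Q , Qs , refl , linkeds , links , vQ , ℓQ =
    u ∷⁺ [] , Q ∷ Qs , refl , [-] ∷ linkeds , u~w ∷ₗ links , cong (u ∷_) vQ , ℓQ

  toGCycle-jump : (p : Walk u v) (e : part v ≡ part u) → Unique (vertices p) →
                  GCycleOn (verticesᶜ (p ↺ inj₂ e)) (ℓᶜ (p ↺ inj₂ e))
  toGCycle-jump {u} p e uniq with segments p (u ∷⁺ []) e
  ... | Q , Qs , refl , linkeds , links , vQ , ℓQ =
    pathsG (Q ∷ Qs) , (subst Unique (sym vQ) uniq , linkeds , relinkʳ (Q ∷ Qs) refl links) ,
    ↭-reflexive vQ , ≤-reflexive (trans (+-identityʳ _) (sym ℓQ))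

  ArcsOnly : Walk u v → Set
  ArcsOnly ε            = ⊤
  ArcsOnly (inj₁ _ ◅ p) = ArcsOnly p
  ArcsOnly (inj₂ _ ◅ p) = ⊥

  arcs-only-or-jump : (p : Walk u v) →
                      ArcsOnly p ⊎ Σ Vertex λ x → Σ Vertex λ y →
                                     Σ (part x ≡ part y) λ e → Cut p (inj₂ e)
  arcs-only-or-jump ε            = inj₁ tt
  arcs-only-or-jump (inj₂ e ◅ p) = inj₂ (_ , _ , e , cut ε (inj₂ e) p)
  arcs-only-or-jump (inj₁ r ◅ p) =
    Sum.map₂ (λ (x , y , e , c) → x , y , e , cut-∷ (inj₁ r) c) (arcs-only-or-jump p)

  arcs-only-linked : (p : Walk u v) → ArcsOnly p → Arc v z →
                     Linked Arc (vertices p ∷ʳ z) × length (vertices p) ≡ suc (ℓʷ p)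
  arcs-only-linked ε            _    vz = vz ∷ₗ [-] , refl
  arcs-only-linked (inj₁ r ◅ p) arcs vz =
    let linked , length≡ = arcs-only-linked p arcs vz in r ∷ₗ linked , cong suc length≡

  toGCycle-directed : (p : Walk u v) (r : Arc v u) → ArcsOnly p → Unique (vertices p) →
                    GCycleOn (verticesᶜ (p ↺ inj₁ r)) (ℓᶜ (p ↺ inj₁ r))
  toGCycle-directed ε            r _    _    = ⊥-elim (A-irrefl _ r)
  toGCycle-directed p@(_ ◅ _) r arcs uniq =
    let linked , length≡ = arcs-only-linked p arcs r
    in cycleG (vertices p) , (s≤s z≤n , uniq , linked) , ↭-refl ,
       ≤-reflexive (trans (+-comm _ 1) (sym length≡))

  toGCycle : (c : ClosedWalk) → Unique (verticesᶜ c) → GCycleOn (verticesᶜ c) (ℓᶜ c)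
  toGCycle (p ↺ inj₂ e) uniq = toGCycle-jump p e uniq
  toGCycle (p ↺ inj₁ r) uniq with arcs-only-or-jump p
  ... | inj₁ arcs                          = toGCycle-directed p r arcs uniq
  ... | inj₂ (_ , _ , e , cut p₁ _ p₂) =
    let rotated↭ , ℓrotated = rotate-cut p₁ (inj₂ e) p₂ (inj₁ r)
    in GCycleOn-resp rotated↭ (≤-reflexive (sym ℓrotated))
         (toGCycle-jump (p₂ ◅◅ inj₁ r ◅ p₁) e (Unique-resp-↭ (↭-sym rotated↭) uniq))

  toGCycle-tour : Tour L n → Unique L → GCycleOn L n
  toGCycle-tour (c , c↭L , n≤c) uniq =
    GCycleOn-resp c↭L n≤c (toGCycle c (Unique-resp-↭ (↭-sym c↭L) uniq))

  merge-GCycles : (C₁ C₂ : GCyc) → IsGCycle C₁ → IsGCycle C₂ →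
                  (∀ v → v ∈ verts C₁ → v ∈ verts C₂ → ⊥) → verts C₁ ⇄ verts C₂ →
                  GCycleOn (verts C₁ ++ verts C₂) (len C₁ + len C₂)
  merge-GCycles C₁ C₂ isC₁ isC₂ disjoint C₁⇄C₂ with fromGCycle C₁ isC₁ | fromGCycle C₂ isC₂
  ... | a , va , ℓa | b , vb , ℓb =
    toGCycle-tour (subst₂ Tour (cong₂ _++_ va vb) (cong₂ _+_ ℓa ℓb) merged)
      (Uniqueₚ.++⁺ (unique C₁ isC₁) (unique C₂ isC₂) λ (v∈₁ , v∈₂) → disjoint _ v∈₁ v∈₂)
    where
    merged : Tour (verticesᶜ a ++ verticesᶜ b) (ℓᶜ a + ℓᶜ b)
    merged = merge _ a b ≤-refl (subst Unique (sym vb) (unique C₂ isC₂))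
                   (subst₂ _⇄_ (sym va) (sym vb) C₁⇄C₂)

lemma6p3 : (D : ESD) → let open ESD D in
  (C₁ C₂ : GCyc) → IsGCycle C₁ → IsGCycle C₂ →
  (∀ v → v ∈ verts C₁ → v ∈ verts C₂ → ⊥) →
  (∃ λ u → ∃ λ v → u ∈ verts C₁ × v ∈ verts C₂ × Arc u v) →
  (∃ λ u → ∃ λ v → u ∈ verts C₂ × v ∈ verts C₁ × Arc u v) →
  Σ GCyc λ C → IsGCycle C
    × (∀ v → (v ∈ verts C → v ∈ verts C₁ ⊎ v ∈ verts C₂)
           × (v ∈ verts C₁ ⊎ v ∈ verts C₂ → v ∈ verts C))
    × len C ≥ len C₁ + len C₂
lemma6p3 D C₁ C₂ isC₁ isC₂ disjoint arc₁₂ arc₂₁ =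
  let C , isC , C↭ , len≤ = merge-GCycles D C₁ C₂ isC₁ isC₂ disjoint (arc₁₂ , arc₂₁)
  in C , isC , ∈-↭-++ C↭ , len≤
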